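{- With the $2\times 2$ matrices $$V(d,a,b;\lambda,\mu)=\begin{pmatrix}\mu\frac ab&\lambda\frac db\\0&1\end{pmatrix},\ V'(d,a,b;\lambda,\mu)=\begin{pmatrix}\frac ab&\lambda\frac db\\0&1\end{pmatrix},\ U(a,b,c;\lambda,\mu)=\begin{pmatrix}1&0\\\frac cb&\frac ab\end{pmatrix},\ U'(a,b,c;\lambda,\mu)=\begin{pmatrix}1&0\\\frac cb&\mu\frac ab\end{pmatrix}$$ (all variables nonzero), and for a $2\times2$ matrix $M$ and $1\le i\le N-1$ letting $M_i$ denote the $N\times N$ matrix equal to the identity except that its entries in rows and columns $i,i+1$ are those of $M$, we have $$U_i(a,b,c;\lambda,\mu)\,V_{i+1}(b,c,d;\lambda,\mu)=V'_{i+1}(a,c,d;\lambda,\mu)\,U'_i(a,b,d;\lambda,\mu),$$ and, for all $j\notin\{i,i-1\}$ and all arguments, $$[V_i(c,a,b),U_j(d,e,f)]=[V'_i(c,a,b),U_j(d,e,f)]=[V_i(c,a,b),U'_j(d,e,f)]=[V'_i(c,a,b),U'_j(d,e,f)]=0.$$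
   Context: $[X,Y]=XY-YX$. In the commutation relations the parameters $\lambda,\mu$ are arbitrary (suppressed in the notation). -}

module Defs where

open import Level using (Level; _⊔_) renaming (suc to lsuc)
open import Algebra.Bundles using (CommutativeRing)
open import Data.Nat as ℕ using (ℕ; zero; suc; _≟_)
open import Data.Fin using (Fin; toℕ)
import Data.Fin as Fin
open import Relation.Nullary using (¬_; yes; no)

-- A field: a commutative ring with 0 ≠ 1 and a (total) inverse function
-- which is a genuine multiplicative inverse on every nonzero element.
-- (The value of inv 0 is irrelevant; all statements only divide by
-- elements assumed nonzero.)
record Field (c ℓ : Level) : Set (lsuc (c ⊔ ℓ)) where
  field
    commutativeRing : CommutativeRing c ℓ
  open CommutativeRing commutativeRing public
  field
    inv         : Carrier → Carrier
    inverse     : ∀ x → ¬ (x ≈ 0#) → x * inv x ≈ 1#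
    0≉1         : ¬ (0# ≈ 1#)

module FieldMatrices {c ℓ} (F : Field c ℓ) where
  open Field F

  _÷_ : Carrier → Carrier → Carrier
  x ÷ y = x * inv y

  Mat : ℕ → Set c
  Mat N = Fin N → Fin N → Carrier

  record Mat2 : Set c where
    constructor mat2
    field
      m11 m12 m21 m22 : Carrier

  sumFin : ∀ n → (Fin n → Carrier) → Carrier
  sumFin zero    f = 0#
  sumFin (suc n) f = f Fin.zero + sumFin n (λ k → f (Fin.suc k))

  _⊗_ : ∀ {N} → Mat N → Mat N → Mat N
  (A ⊗ B) k l = sumFin _ (λ m → A k m * B m l)

  ⟦_,_⟧ : ∀ {N} → Mat N → Mat N → Mat N
  ⟦ A , B ⟧ k l = (A ⊗ B) k l - (B ⊗ A) k l

  _≋_ : ∀ {N} → Mat N → Mat N → Set ℓ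
  A ≋ B = ∀ k l → A k l ≈ B k l

  zeroMat : ∀ {N} → Mat N
  zeroMat k l = 0#

  -- Embedding M_i (1 ≤ i ≤ N-1, rows/columns numbered 1..N):
  -- the identity except that the entries in rows and columns i, i+1
  -- are those of M.  A Fin N index k corresponds to row toℕ k + 1.
  embed : (N i : ℕ) → Mat2 → Mat N
  embed N i (mat2 a b c' d) k l = go (suc (toℕ k)) (suc (toℕ l))
    where
    idEntry : ℕ → ℕ → Carrier
    idEntry r s with r ≟ s
    ... | yes _ = 1#
    ... | no  _ = 0#
    go : ℕ → ℕ → Carrier
    go r s with r ≟ i | r ≟ suc i | s ≟ i | s ≟ suc i
    ... | yes _ | _     | yes _ | _     = a
    ... | yes _ | _     | no _  | yes _ = b
    ... | no _  | yes _ | yes _ | _     = c'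
    ... | no _  | yes _ | no _  | yes _ = d
    ... | _     | _     | _     | _     = idEntry r s

  V : (d a b lam mu : Carrier) → Mat2
  V d a b lam mu = mat2 (mu * (a ÷ b)) (lam * (d ÷ b)) 0# 1#

  V′ : (d a b lam mu : Carrier) → Mat2
  V′ d a b lam mu = mat2 (a ÷ b) (lam * (d ÷ b)) 0# 1#

  U : (a b c lam mu : Carrier) → Mat2
  U a b c lam mu = mat2 1# 0# (c ÷ b) (a ÷ b)

  U′ : (a b c lam mu : Carrier) → Mat2
  U′ a b c lam mu = mat2 1# 0# (c ÷ b) (mu * (a ÷ b))

-- Left multiplication by an embedded 2×2 matrix M_i is a row operation: row i of M_i ⊗ B is
-- M₁₁·(row i of B) + M₁₂·(row i+1 of B), row i+1 likewise, and every other row of B is kept.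
-- V and V′ have bottom row (0, 1), U and U′ have top row (1, 0), so each of them only changes a
-- single row.  For j ∉ {i, i-1} the row that V_i (resp. U_j) changes is a combination of rows
-- that U_j (resp. V_i) keeps, so the two products agree row by row.
-- In the braid relation both sides only change row i+1, into the same combination of rows
-- i, i+1, i+2; comparing coefficients uses b·b⁻¹ = d·d⁻¹ = 1.

module Submission where

open import Defs
open import Data.Empty using (⊥-elim)
open import Data.Fin using (Fin; toℕ)
import Data.Fin as Fin
open import Data.Fin.Properties using (toℕ-fromℕ<)
open import Data.Nat using (ℕ; zero; suc; _≟_; _≤_; s≤s; z≤n)
open import Data.Nat.Properties using (1+n≢n; suc-injective; <⇒≤)
open import Data.Product using (Σ; _×_; _,_)
open import Relation.Nullary using (¬_; yes; no)
open import Relation.Binary.PropositionalEquality as P using (_≡_; _≢_; cong; ≢-sym)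
open import Function using (_∘_; case_of_)

module EmbeddedMatrices {c ℓ} (F : Field c ℓ) where
  open Field F
  open FieldMatrices F
  open import Algebra.Solver.Ring.NaturalCoefficients.Default commutativeSemiring
    using (solve; _:=_; _:+_; _:*_; con)
  open import Relation.Binary.Reasoning.Setoid setoid

  δ : ℕ → ℕ → Carrier
  δ zero    zero    = 1#
  δ zero    (suc s) = 0#
  δ (suc r) zero    = 0#
  δ (suc r) (suc s) = δ r s

  δ-diagonal : ∀ {r s} → r ≡ s → δ r s ≈ 1#
  δ-diagonal {zero}  P.refl = refl
  δ-diagonal {suc r} P.refl = δ-diagonal {r} P.refl

  δ-offDiagonal : ∀ {r s} → r ≢ s → δ r s ≈ 0#
  δ-offDiagonal {zero}  {zero}  r≢s = ⊥-elim (r≢s P.refl)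
  δ-offDiagonal {zero}  {suc s} r≢s = refl
  δ-offDiagonal {suc r} {zero}  r≢s = refl
  δ-offDiagonal {suc r} {suc s} r≢s = δ-offDiagonal (r≢s ∘ cong suc)

  rowNo : ∀ {N} → Fin N → ℕ
  rowNo k = suc (toℕ k)

  -- The unit row with its 1 in row r, rows numbered from 1 as in embed; e 0 is the zero row.
  e : ∀ {N} → ℕ → Fin N → Carrier
  e r m = δ r (rowNo m)

  δ-pair-first : ∀ x y {r s t} → r ≡ t → s ≢ t → x * δ r t + y * δ s t ≈ x
  δ-pair-first x y {r} {s} {t} r≡t s≢t = begin
    x * δ r t + y * δ s t ≈⟨ +-cong (*-congˡ (δ-diagonal r≡t)) (*-congˡ (δ-offDiagonal s≢t)) ⟩
    x * 1# + y * 0#       ≈⟨ solve 2 (λ x y → x :* con 1 :+ y :* con 0 := x) refl x y ⟩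
    x                     ∎

  δ-pair-second : ∀ x y {r s t} → r ≢ t → s ≡ t → x * δ r t + y * δ s t ≈ y
  δ-pair-second x y {r} {s} {t} r≢t s≡t = begin
    x * δ r t + y * δ s t ≈⟨ +-cong (*-congˡ (δ-offDiagonal r≢t)) (*-congˡ (δ-diagonal s≡t)) ⟩
    x * 0# + y * 1#       ≈⟨ solve 2 (λ x y → x :* con 0 :+ y :* con 1 := y) refl x y ⟩
    y                     ∎

  δ-pair-neither : ∀ x y {r s t} → r ≢ t → s ≢ t → x * δ r t + y * δ s t ≈ 0#
  δ-pair-neither x y {r} {s} {t} r≢t s≢t = begin
    x * δ r t + y * δ s t ≈⟨ +-cong (*-congˡ (δ-offDiagonal r≢t)) (*-congˡ (δ-offDiagonal s≢t)) ⟩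
    x * 0# + y * 0#       ≈⟨ solve 2 (λ x y → x :* con 0 :+ y :* con 0 := con 0) refl x y ⟩
    0#                    ∎

  embed-row-top : ∀ N i a b c′ d (k : Fin N) → rowNo k ≡ i →
                  ∀ m → embed N i (mat2 a b c′ d) k m ≈ a * e i m + b * e (suc i) m
  embed-row-top N i a b c′ d k k≡i m with rowNo k ≟ i | rowNo m ≟ i | rowNo m ≟ suc i
  ... | no k≢i | _     | _     = ⊥-elim (k≢i k≡i)
  ... | yes _  | yes p | _     = sym (δ-pair-first a b (P.sym p) (λ q → 1+n≢n (P.trans q p)))
  ... | yes _  | no ¬p | yes q = sym (δ-pair-second a b (¬p ∘ P.sym) (P.sym q))
  ... | yes _  | no ¬p | no ¬q with rowNo k ≟ rowNo m
  ...   | yes r = ⊥-elim (¬p (P.trans (P.sym r) k≡i))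
  ...   | no ¬r = sym (δ-pair-neither a b (¬p ∘ P.sym) (¬q ∘ P.sym))

  embed-row-bottom : ∀ N i a b c′ d (k : Fin N) → rowNo k ≡ suc i →
                     ∀ m → embed N i (mat2 a b c′ d) k m ≈ c′ * e i m + d * e (suc i) m
  embed-row-bottom N i a b c′ d k k≡si m with rowNo k ≟ i | rowNo k ≟ suc i | rowNo m ≟ i | rowNo m ≟ suc i
  ... | yes k≡i | _       | _     | _     = ⊥-elim (1+n≢n (P.trans (P.sym k≡si) k≡i))
  ... | no _    | no k≢si | _     | _     = ⊥-elim (k≢si k≡si)
  ... | no _    | yes _   | yes p | _     = sym (δ-pair-first c′ d (P.sym p) (λ q → 1+n≢n (P.trans q p)))
  ... | no _    | yes _   | no ¬p | yes q = sym (δ-pair-second c′ d (¬p ∘ P.sym) (P.sym q))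
  ... | no _    | yes _   | no ¬p | no ¬q with rowNo k ≟ rowNo m
  ...   | yes r = ⊥-elim (¬q (P.trans (P.sym r) k≡si))
  ...   | no ¬r = sym (δ-pair-neither c′ d (¬p ∘ P.sym) (¬q ∘ P.sym))

  embed-row-outside : ∀ N i a b c′ d (k : Fin N) → rowNo k ≢ i → rowNo k ≢ suc i →
                      ∀ m → embed N i (mat2 a b c′ d) k m ≈ e (rowNo k) m
  embed-row-outside N i a b c′ d k ≢i ≢si m with rowNo k ≟ i | rowNo k ≟ suc i
  ... | yes p | _     = ⊥-elim (≢i p)
  ... | no _  | yes q = ⊥-elim (≢si q)
  ... | no _  | no _  with rowNo k ≟ rowNo m
  ...   | yes p = sym (δ-diagonal p)
  ...   | no ¬p = sym (δ-offDiagonal ¬p)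

  IsUnitRow : ∀ {N} → Mat N → Fin N → Set ℓ
  IsUnitRow A k = ∀ m → A k m ≈ e (rowNo k) m

  unitRow-at : ∀ {N} (A : Mat N) {p r} → IsUnitRow A p → rowNo p ≡ r → ∀ l → A p l ≈ e r l
  unitRow-at A unit P.refl = unit

  embed-topUnit-unitRow : ∀ N i c′ d (k : Fin N) → rowNo k ≢ suc i →
                          IsUnitRow (embed N i (mat2 1# 0# c′ d)) k
  embed-topUnit-unitRow N i c′ d k k≢si m = case rowNo k ≟ i of λ where
    (yes k≡i) → begin
      embed N i (mat2 1# 0# c′ d) k m ≈⟨ embed-row-top N i 1# 0# c′ d k k≡i m ⟩
      1# * e i m + 0# * e (suc i) m   ≈⟨ solve 2 (λ X Y → con 1 :* X :+ con 0 :* Y := X) refl _ _ ⟩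
      e i m                           ≡⟨ cong (λ r → e r m) (P.sym k≡i) ⟩
      e (rowNo k) m                   ∎
    (no k≢i) → embed-row-outside N i 1# 0# c′ d k k≢i k≢si m

  embed-bottomUnit-unitRow : ∀ N i a b (k : Fin N) → rowNo k ≢ i →
                             IsUnitRow (embed N i (mat2 a b 0# 1#)) k
  embed-bottomUnit-unitRow N i a b k k≢i m = case rowNo k ≟ suc i of λ where
    (yes k≡si) → begin
      embed N i (mat2 a b 0# 1#) k m  ≈⟨ embed-row-bottom N i a b 0# 1# k k≡si m ⟩
      0# * e i m + 1# * e (suc i) m   ≈⟨ solve 2 (λ X Y → con 0 :* X :+ con 1 :* Y := Y) refl _ _ ⟩
      e (suc i) m                     ≡⟨ cong (λ r → e r m) (P.sym k≡si) ⟩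
      e (rowNo k) m                   ∎
    (no k≢si) → embed-row-outside N i a b 0# 1# k k≢i k≢si m

  sumFin-cong : ∀ n {f g : Fin n → Carrier} → (∀ m → f m ≈ g m) → sumFin n f ≈ sumFin n g
  sumFin-cong zero    f≈g = refl
  sumFin-cong (suc n) f≈g = +-cong (f≈g Fin.zero) (sumFin-cong n (f≈g ∘ Fin.suc))

  sumFin-zero : ∀ n {f : Fin n → Carrier} → (∀ m → f m ≈ 0#) → sumFin n f ≈ 0#
  sumFin-zero zero    f≈0 = refl
  sumFin-zero (suc n) f≈0 =
    trans (+-cong (f≈0 Fin.zero) (sumFin-zero n (f≈0 ∘ Fin.suc))) (+-identityˡ 0#)

  sumFin-unitRow : ∀ n (p : Fin n) (g : Fin n → Carrier) → sumFin n (λ m → e (rowNo p) m * g m) ≈ g p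
  sumFin-unitRow (suc n) Fin.zero    g = begin
    1# * g Fin.zero + sumFin n (λ m → 0# * g (Fin.suc m))
      ≈⟨ +-cong (*-identityˡ _) (sumFin-zero n (λ m → zeroˡ _)) ⟩
    g Fin.zero + 0#
      ≈⟨ +-identityʳ _ ⟩
    g Fin.zero ∎
  sumFin-unitRow (suc n) (Fin.suc p) g = begin
    0# * g Fin.zero + sumFin n (λ m → e (rowNo p) m * g (Fin.suc m))
      ≈⟨ +-cong (zeroˡ _) (sumFin-unitRow n p (g ∘ Fin.suc)) ⟩
    0# + g (Fin.suc p)
      ≈⟨ +-identityˡ _ ⟩
    g (Fin.suc p) ∎

  sumFin-linear : ∀ n x y (u v g : Fin n → Carrier) →
                  sumFin n (λ m → (x * u m + y * v m) * g m)
                    ≈ x * sumFin n (λ m → u m * g m) + y * sumFin n (λ m → v m * g m)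
  sumFin-linear zero    x y u v g = solve 2 (λ x y → con 0 := x :* con 0 :+ y :* con 0) refl x y
  sumFin-linear (suc n) x y u v g = begin
    (x * u₀ + y * v₀) * g₀ + sumFin n (λ m → (x * u (Fin.suc m) + y * v (Fin.suc m)) * g (Fin.suc m))
      ≈⟨ +-congˡ (sumFin-linear n x y (u ∘ Fin.suc) (v ∘ Fin.suc) (g ∘ Fin.suc)) ⟩
    (x * u₀ + y * v₀) * g₀ + (x * Σu + y * Σv)
      ≈⟨ solve 7 (λ x y u v g U V → (x :* u :+ y :* v) :* g :+ (x :* U :+ y :* V)
                                     := x :* (u :* g :+ U) :+ y :* (v :* g :+ V)) refl x y u₀ v₀ g₀ Σu Σv ⟩
    x * (u₀ * g₀ + Σu) + y * (v₀ * g₀ + Σv) ∎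
    where
    u₀ v₀ g₀ Σu Σv : Carrier
    u₀ = u Fin.zero
    v₀ = v Fin.zero
    g₀ = g Fin.zero
    Σu = sumFin n (λ m → u (Fin.suc m) * g (Fin.suc m))
    Σv = sumFin n (λ m → v (Fin.suc m) * g (Fin.suc m))

  ⊗-unitRow : ∀ {N} (A B : Mat N) k → IsUnitRow A k → ∀ l → (A ⊗ B) k l ≈ B k l
  ⊗-unitRow {N} A B k unit l =
    trans (sumFin-cong N (λ m → *-congʳ (unit m))) (sumFin-unitRow N k (λ m → B m l))

  ⊗-pairRow : ∀ {N} (A B : Mat N) k x y (p q : Fin N) {r s} → rowNo p ≡ r → rowNo q ≡ s →
              (∀ m → A k m ≈ x * e r m + y * e s m) → ∀ l → (A ⊗ B) k l ≈ x * B p l + y * B q l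
  ⊗-pairRow {N} A B k x y p q P.refl P.refl pair l = begin
    sumFin N (λ m → A k m * B m l)
      ≈⟨ sumFin-cong N (λ m → *-congʳ (pair m)) ⟩
    sumFin N (λ m → (x * e (rowNo p) m + y * e (rowNo q) m) * B m l)
      ≈⟨ sumFin-linear N x y _ _ _ ⟩
    x * sumFin N (λ m → e (rowNo p) m * B m l) + y * sumFin N (λ m → e (rowNo q) m * B m l)
      ≈⟨ +-cong (*-congˡ (sumFin-unitRow N p _)) (*-congˡ (sumFin-unitRow N q _)) ⟩
    x * B p l + y * B q l ∎

  ⊗-pairRow-unitRows : ∀ {N} (A B : Mat N) k x y (p q : Fin N) {r s} → rowNo p ≡ r → rowNo q ≡ s →
                       (∀ m → A k m ≈ x * e r m + y * e s m) → IsUnitRow B p → IsUnitRow B q →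
                       ∀ l → (A ⊗ B) k l ≈ A k l
  ⊗-pairRow-unitRows A B k x y p q P.refl P.refl pair p-unit q-unit l = begin
    (A ⊗ B) k l                              ≈⟨ ⊗-pairRow A B k x y p q P.refl P.refl pair l ⟩
    x * B p l + y * B q l                    ≈⟨ +-cong (*-congˡ (p-unit l)) (*-congˡ (q-unit l)) ⟩
    x * e (rowNo p) l + y * e (rowNo q) l    ≈⟨ pair l ⟨
    A k l                                    ∎

  fromRowNo : ∀ {N r} → 1 ≤ r → r ≤ N → Σ (Fin N) (λ p → rowNo p ≡ r)
  fromRowNo {r = suc r} (s≤s z≤n) r<N = Fin.fromℕ< r<N , cong suc (toℕ-fromℕ< r<N)

  commute⇒commutator≋zero : ∀ {N} (A B : Mat N) → (A ⊗ B) ≋ (B ⊗ A) → ⟦ A , B ⟧ ≋ zeroMat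
  commute⇒commutator≋zero A B AB≋BA k l = trans (+-congʳ (AB≋BA k l)) (-‿inverseʳ _)

  embed-bottomUnit-topUnit-commute :
    ∀ N i j x y z w → 1 ≤ i → suc i ≤ N → 1 ≤ j → suc j ≤ N → j ≢ i → suc j ≢ i →
    let Vᵢ = embed N i (mat2 x y 0# 1#); Uⱼ = embed N j (mat2 1# 0# z w) in (Vᵢ ⊗ Uⱼ) ≋ (Uⱼ ⊗ Vᵢ)
  embed-bottomUnit-topUnit-commute N i j x y z w 1≤i i<N 1≤j j<N j≢i sj≢i k l
    with fromRowNo 1≤i (<⇒≤ i<N) | fromRowNo (s≤s z≤n) i<N
       | fromRowNo 1≤j (<⇒≤ j<N) | fromRowNo (s≤s z≤n) j<N
  ... | pᵢ , pᵢ≡i | pᵢ₊₁ , pᵢ₊₁≡si | pⱼ , pⱼ≡j | pⱼ₊₁ , pⱼ₊₁≡sj =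
    case rowNo k ≟ i of λ where
      (yes k≡i) → begin
        (Vᵢ ⊗ Uⱼ) k l ≈⟨ ⊗-pairRow-unitRows Vᵢ Uⱼ k x y pᵢ pᵢ₊₁ pᵢ≡i pᵢ₊₁≡si
                           (embed-row-top N i x y 0# 1# k k≡i)
                           (Uⱼ-unitRow pᵢ λ eq → sj≢i (P.trans (P.sym eq) pᵢ≡i))
                           (Uⱼ-unitRow pᵢ₊₁ λ eq → j≢i (suc-injective (P.trans (P.sym eq) pᵢ₊₁≡si))) l ⟩
        Vᵢ k l        ≈⟨ ⊗-unitRow Uⱼ Vᵢ k (Uⱼ-unitRow k λ eq → sj≢i (P.trans (P.sym eq) k≡i)) l ⟨
        (Uⱼ ⊗ Vᵢ) k l ∎
      (no k≢i) → case rowNo k ≟ suc j of λ where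
        (yes k≡sj) → begin
          (Vᵢ ⊗ Uⱼ) k l ≈⟨ ⊗-unitRow Vᵢ Uⱼ k (Vᵢ-unitRow k k≢i) l ⟩
          Uⱼ k l        ≈⟨ ⊗-pairRow-unitRows Uⱼ Vᵢ k z w pⱼ pⱼ₊₁ pⱼ≡j pⱼ₊₁≡sj
                             (embed-row-bottom N j 1# 0# z w k k≡sj)
                             (Vᵢ-unitRow pⱼ λ eq → j≢i (P.trans (P.sym pⱼ≡j) eq))
                             (Vᵢ-unitRow pⱼ₊₁ λ eq → sj≢i (P.trans (P.sym pⱼ₊₁≡sj) eq)) l ⟨
          (Uⱼ ⊗ Vᵢ) k l ∎
        (no k≢sj) → begin
          (Vᵢ ⊗ Uⱼ) k l ≈⟨ ⊗-unitRow Vᵢ Uⱼ k (Vᵢ-unitRow k k≢i) l ⟩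
          Uⱼ k l        ≈⟨ Uⱼ-unitRow k k≢sj l ⟩
          e (rowNo k) l ≈⟨ Vᵢ-unitRow k k≢i l ⟨
          Vᵢ k l        ≈⟨ ⊗-unitRow Uⱼ Vᵢ k (Uⱼ-unitRow k k≢sj) l ⟨
          (Uⱼ ⊗ Vᵢ) k l ∎
    where
    Vᵢ Uⱼ : Mat N
    Vᵢ = embed N i (mat2 x y 0# 1#)
    Uⱼ = embed N j (mat2 1# 0# z w)
    Vᵢ-unitRow : ∀ k → rowNo k ≢ i → IsUnitRow Vᵢ k
    Vᵢ-unitRow = embed-bottomUnit-unitRow N i x y
    Uⱼ-unitRow : ∀ k → rowNo k ≢ suc j → IsUnitRow Uⱼ k
    Uⱼ-unitRow = embed-topUnit-unitRow N j z w

  braid-coefficients : ∀ a b c d lam mu → ¬ (b ≈ 0#) → ¬ (d ≈ 0#) → ∀ X Y Z →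
    (c ÷ b) * X + (a ÷ b) * ((mu * (c ÷ d)) * Y + (lam * (b ÷ d)) * Z)
      ≈ (c ÷ d) * ((d ÷ b) * X + (mu * (a ÷ b)) * Y) + (lam * (a ÷ d)) * Z
  braid-coefficients a b c d lam mu b≉0 d≉0 X Y Z = begin
    (c ÷ b) * X + (a ÷ b) * ((mu * (c ÷ d)) * Y + (lam * (b ÷ d)) * Z)
      ≈⟨ solve 11 (λ a b c d b⁻¹ d⁻¹ lam mu X Y Z →
           (c :* b⁻¹) :* X :+ (a :* b⁻¹) :* ((mu :* (c :* d⁻¹)) :* Y :+ (lam :* (b :* d⁻¹)) :* Z)
           := c :* b⁻¹ :* con 1 :* X :+ mu :* a :* c :* b⁻¹ :* d⁻¹ :* Y :+ lam :* a :* d⁻¹ :* (b :* b⁻¹) :* Z)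
           refl a b c d (inv b) (inv d) lam mu X Y Z ⟩
    f 1# (b * inv b)
      ≈⟨ f-cong refl (inverse b b≉0) ⟩
    f 1# 1#
      ≈⟨ f-cong (inverse d d≉0) refl ⟨
    f (d * inv d) 1#
      ≈⟨ solve 11 (λ a b c d b⁻¹ d⁻¹ lam mu X Y Z →
           (c :* d⁻¹) :* ((d :* b⁻¹) :* X :+ (mu :* (a :* b⁻¹)) :* Y) :+ (lam :* (a :* d⁻¹)) :* Z
           := c :* b⁻¹ :* (d :* d⁻¹) :* X :+ mu :* a :* c :* b⁻¹ :* d⁻¹ :* Y :+ lam :* a :* d⁻¹ :* con 1 :* Z)
           refl a b c d (inv b) (inv d) lam mu X Y Z ⟨
    (c ÷ d) * ((d ÷ b) * X + (mu * (a ÷ b)) * Y) + (lam * (a ÷ d)) * Z ∎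
    where
    -- The normal form of both sides, with the factors b·b⁻¹ and d·d⁻¹ on which they differ
    -- left as the arguments u and v.
    f : Carrier → Carrier → Carrier
    f u v = c * inv b * u * X + mu * a * c * inv b * inv d * Y + lam * a * inv d * v * Z
    f-cong : ∀ {u u′ v v′} → u ≈ u′ → v ≈ v′ → f u v ≈ f u′ v′
    f-cong u≈u′ v≈v′ = +-cong (+-congʳ (*-congʳ (*-congˡ u≈u′))) (*-congʳ (*-congˡ v≈v′))

  embed-braid : ∀ N i → 1 ≤ i → suc (suc i) ≤ N → ∀ a b c d lam mu → ¬ (b ≈ 0#) → ¬ (d ≈ 0#) →
    (embed N i (U a b c lam mu) ⊗ embed N (suc i) (V b c d lam mu))
      ≋ (embed N (suc i) (V′ a c d lam mu) ⊗ embed N i (U′ a b d lam mu))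
  embed-braid N i 1≤i i+1<N a b c d lam mu b≉0 d≉0 k l
    with fromRowNo 1≤i (<⇒≤ (<⇒≤ i+1<N)) | fromRowNo (s≤s z≤n) (<⇒≤ i+1<N) | fromRowNo (s≤s z≤n) i+1<N
  ... | pᵢ , P.refl | pᵢ₊₁ , pᵢ₊₁≡si | pᵢ₊₂ , pᵢ₊₂≡ssi =
    case rowNo k ≟ suc i of λ where
      (yes k≡si) → begin
        (Uᵢ ⊗ Vᵢ₊₁) k l
          ≈⟨ ⊗-pairRow Uᵢ Vᵢ₊₁ k (c ÷ b) (a ÷ b) pᵢ pᵢ₊₁ P.refl pᵢ₊₁≡si
               (embed-row-bottom N i 1# 0# (c ÷ b) (a ÷ b) k k≡si) l ⟩
        (c ÷ b) * Vᵢ₊₁ pᵢ l + (a ÷ b) * Vᵢ₊₁ pᵢ₊₁ l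
          ≈⟨ +-cong (*-congˡ (embed-bottomUnit-unitRow N (suc i) _ _ pᵢ (≢-sym 1+n≢n) l))
                    (*-congˡ (embed-row-top N (suc i) _ _ 0# 1# pᵢ₊₁ pᵢ₊₁≡si l)) ⟩
        (c ÷ b) * e i l + (a ÷ b) * ((mu * (c ÷ d)) * e (suc i) l + (lam * (b ÷ d)) * e (suc (suc i)) l)
          ≈⟨ braid-coefficients a b c d lam mu b≉0 d≉0 _ _ _ ⟩
        (c ÷ d) * ((d ÷ b) * e i l + (mu * (a ÷ b)) * e (suc i) l) + (lam * (a ÷ d)) * e (suc (suc i)) l
          ≈⟨ +-cong (*-congˡ (embed-row-bottom N i 1# 0# _ _ pᵢ₊₁ pᵢ₊₁≡si l))
                    (*-congˡ (unitRow-at U′ᵢ (embed-topUnit-unitRow N i _ _ pᵢ₊₂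
                                                (1+n≢n ∘ P.trans (P.sym pᵢ₊₂≡ssi))) pᵢ₊₂≡ssi l)) ⟨
        (c ÷ d) * U′ᵢ pᵢ₊₁ l + (lam * (a ÷ d)) * U′ᵢ pᵢ₊₂ l
          ≈⟨ ⊗-pairRow V′ᵢ₊₁ U′ᵢ k (c ÷ d) (lam * (a ÷ d)) pᵢ₊₁ pᵢ₊₂ pᵢ₊₁≡si pᵢ₊₂≡ssi
               (embed-row-top N (suc i) (c ÷ d) (lam * (a ÷ d)) 0# 1# k k≡si) l ⟨
        (V′ᵢ₊₁ ⊗ U′ᵢ) k l ∎
      (no k≢si) → begin
        (Uᵢ ⊗ Vᵢ₊₁) k l   ≈⟨ ⊗-unitRow Uᵢ Vᵢ₊₁ k (embed-topUnit-unitRow N i _ _ k k≢si) l ⟩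
        Vᵢ₊₁ k l          ≈⟨ embed-bottomUnit-unitRow N (suc i) _ _ k k≢si l ⟩
        e (rowNo k) l     ≈⟨ embed-topUnit-unitRow N i _ _ k k≢si l ⟨
        U′ᵢ k l           ≈⟨ ⊗-unitRow V′ᵢ₊₁ U′ᵢ k (embed-bottomUnit-unitRow N (suc i) _ _ k k≢si) l ⟨
        (V′ᵢ₊₁ ⊗ U′ᵢ) k l ∎
    where
    Uᵢ Vᵢ₊₁ V′ᵢ₊₁ U′ᵢ : Mat N
    Uᵢ = embed N i (U a b c lam mu)
    Vᵢ₊₁ = embed N (suc i) (V b c d lam mu)
    V′ᵢ₊₁ = embed N (suc i) (V′ a c d lam mu)
    U′ᵢ = embed N i (U′ a b d lam mu)

  embed-bottomUnit-topUnit-commutator :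
    ∀ N i j x y z w → 1 ≤ i → suc i ≤ N → 1 ≤ j → suc j ≤ N → j ≢ i → suc j ≢ i →
    ⟦ embed N i (mat2 x y 0# 1#) , embed N j (mat2 1# 0# z w) ⟧ ≋ zeroMat
  embed-bottomUnit-topUnit-commutator N i j x y z w 1≤i i<N 1≤j j<N j≢i sj≢i =
    commute⇒commutator≋zero _ _ (embed-bottomUnit-topUnit-commute N i j x y z w 1≤i i<N 1≤j j<N j≢i sj≢i)

lemma4p2 : ∀ {c ℓ} (F : Field c ℓ) → let open Field F in let open FieldMatrices F in
    (∀ (N i : ℕ) → 1 ≤ i → suc (suc i) ≤ N →
      ∀ (a b c d lam mu : Carrier) →
      ¬ (a ≈ 0#) → ¬ (b ≈ 0#) → ¬ (c ≈ 0#) → ¬ (d ≈ 0#) →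
      (embed N i (U a b c lam mu) ⊗ embed N (suc i) (V b c d lam mu))
        ≋ (embed N (suc i) (V′ a c d lam mu) ⊗ embed N i (U′ a b d lam mu)))
    ×
    (∀ (N i j : ℕ) → 1 ≤ i → suc i ≤ N → 1 ≤ j → suc j ≤ N →
      ¬ (j ≡ i) → ¬ (suc j ≡ i) →
      ∀ (a b c d e f lam mu : Carrier) →
      ¬ (a ≈ 0#) → ¬ (b ≈ 0#) → ¬ (c ≈ 0#) →
      ¬ (d ≈ 0#) → ¬ (e ≈ 0#) → ¬ (f ≈ 0#) →
      (⟦ embed N i (V c a b lam mu) , embed N j (U d e f lam mu) ⟧ ≋ zeroMat)
      × (⟦ embed N i (V′ c a b lam mu) , embed N j (U d e f lam mu) ⟧ ≋ zeroMat)
      × (⟦ embed N i (V c a b lam mu) , embed N j (U′ d e f lam mu) ⟧ ≋ zeroMat)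
      × (⟦ embed N i (V′ c a b lam mu) , embed N j (U′ d e f lam mu) ⟧ ≋ zeroMat))
lemma4p2 F =
  (λ N i 1≤i i+1<N a b c d lam mu _ b≉0 _ d≉0 → embed-braid N i 1≤i i+1<N a b c d lam mu b≉0 d≉0) ,
  (λ N i j 1≤i i<N 1≤j j<N j≢i sj≢i _ _ _ _ _ _ _ _ _ _ _ _ _ _ →
    let [V,U]≋0 = λ x y z w → embed-bottomUnit-topUnit-commutator N i j x y z w 1≤i i<N 1≤j j<N j≢i sj≢i
    in [V,U]≋0 _ _ _ _ , [V,U]≋0 _ _ _ _ , [V,U]≋0 _ _ _ _ , [V,U]≋0 _ _ _ _)
  where open EmbeddedMatrices F
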